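{- Let $n\ge 2$ and let $P=(r_0,\dots,r_{2^n-1})$ be an $n$-bit permutation with $r_x\equiv x\pmod 2$ for all $x$. Let $0\le l\le 2^{n-1}-1$ be such that $P$ has blocks at block-wise positions $0,1,\dots,l-1$, let $m$ be the smallest positive integer with $2l\le\sum_{j=1}^{m-1}2^{n-j}$, and put $h_n(x)=2^n-2^{n-(x-1)}$. Suppose moreover that $P$ has a block at some block-wise position $s\ge l$ with $2s\ge h_n(m)$. Let $i'=l-h_n(m-1)/2$ if $m>1$ and $i'=l$ if $m=1$, and let $HW(i')$ be the Hamming weight (number of ones) of the binary representation of $i'$. Then there is a finite sequence of gates consisting of at most $n-m$ CNOT gates and at most one gate $CX_{I:k}$ with $|I|\le HW(i')$ such that the permutation $P'=(r'_x)$ obtained by applying it to $P$ has blocks at all block-wise positions $0,1,\dots,l-1$ and, in addition, has at block-wise position $l$ the block formed by the row numbers $r_{2s},r_{2s+1}$, i.e. $r'_{2l}=r_{2s}$ and $r'_{2l+1}=r_{2s+1}$.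
   Context: An $n$-bit permutation is a bijection of $\{0,\dots,2^n-1\}$ in one-line notation $P=(r_0,\dots,r_{2^n-1})$; $x$ is the column number and $r_x$ the row number. Each $x\in\{0,\dots,2^n-1\}$ is identified with its $n$-bit binary string $x_1x_2\cdots x_n$, $x_1$ most significant. Block-wise position $t$ ($0\le t\le 2^{n-1}-1$) consists of columns $2t,2t+1$; $P$ has a block there if $r_{2t+1}=r_{2t}+1$. Gates: for $I\subseteq\{1,\dots,n\}$ and $k\notin I$, $CX_{I:k}$ is the bijection of $\{0,1\}^n$ flipping bit $k$ of $x$ if $x_i=1$ for all $i\in I$ and fixing $x$ otherwise ($C^{|I|}X$ gate); a CNOT gate is $CX_{I:k}$ with $|I|=1$. Applying a gate $g$ to $P=(r_x)$ gives $(r'_x)$ with $r'_x=r_{g(x)}$; sequences of gates are applied in order. -}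

module Defs where

open import Data.Nat using (ℕ; zero; suc; _+_; _*_; _∸_; _^_; _≤_; _<_; _/_; _%_; _≡ᵇ_)
open import Data.Bool using (Bool; true; false; not; _∨_; if_then_else_)
open import Data.Fin using (Fin; toℕ)
open import Data.Fin.Subset using (Subset; _∉_; ∣_∣)
open import Data.Vec using (lookup)
open import Data.List using (List; []; _∷_; allFin; length; _++_)
open import Data.List.Relation.Unary.All using (All)
open import Data.Maybe using (Maybe)
open import Relation.Binary.PropositionalEquality using (_≡_)
open import Data.Product using (_×_)
open import Relation.Nullary using (¬_)

shiftR : ℕ → ℕ → ℕ
shiftR zero    x = x
shiftR (suc e) x = shiftR e (x / 2)

-- Bit positions of an n-bit string x = x_1 x_2 ... x_n (x_1 most significant).
-- The position j : Fin n stands for bit x_{j+1}, which has weight 2^(n - (j+1)).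
weightExp : (n : ℕ) → Fin n → ℕ
weightExp n j = n ∸ suc (toℕ j)

testBit : (n : ℕ) → Fin n → ℕ → Bool
testBit n j x = shiftR (weightExp n j) x % 2 ≡ᵇ 1

flipBit : (n : ℕ) → Fin n → ℕ → ℕ
flipBit n j x = if testBit n j x then x ∸ 2 ^ weightExp n j else x + 2 ^ weightExp n j

record Gate (n : ℕ) : Set where
  constructor CX
  field
    ctrl    : Subset n
    tgt     : Fin n
    tgt∉ctrl : tgt ∉ ctrl
open Gate public

allB : {A : Set} → (A → Bool) → List A → Bool
allB p []       = true
allB p (a ∷ as) = if p a then allB p as else false

controlsOn : (n : ℕ) → Subset n → ℕ → Bool
controlsOn n I x = allB (λ j → not (lookup I j) ∨ testBit n j x) (allFin n)

gateFun : {n : ℕ} → Gate n → ℕ → ℕ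
gateFun {n} g x = if controlsOn n (ctrl g) x then flipBit n (tgt g) x else x

IsCNOT : {n : ℕ} → Gate n → Set
IsCNOT g = ∣ ctrl g ∣ ≡ 1

-- Permutations in one-line notation: P x = r_x (only values on x < 2^n matter).
IsPerm : ℕ → (ℕ → ℕ) → Set
IsPerm n P = (∀ x → x < 2 ^ n → P x < 2 ^ n)
           × (∀ x y → x < 2 ^ n → y < 2 ^ n → P x ≡ P y → x ≡ y)

applyGate : {n : ℕ} → (ℕ → ℕ) → Gate n → (ℕ → ℕ)
applyGate P g x = P (gateFun g x)

applyGates : {n : ℕ} → (ℕ → ℕ) → List (Gate n) → (ℕ → ℕ)
applyGates P []       = P
applyGates P (g ∷ gs) = applyGates (applyGate P g) gs

HasBlock : (ℕ → ℕ) → ℕ → Set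
HasBlock P t = P (suc (2 * t)) ≡ suc (P (2 * t))

sumPow : ℕ → ℕ → ℕ
sumPow n zero          = 0
sumPow n (suc zero)    = 0
sumPow n (suc (suc k)) = sumPow n (suc k) + 2 ^ (n ∸ suc k)

h : ℕ → ℕ → ℕ
h n x = 2 ^ n ∸ 2 ^ (n ∸ (x ∸ 1))

-- Hamming weight of the binary representation (fuel x suffices since x/2 < x)
hwFuel : ℕ → ℕ → ℕ
hwFuel zero    x = 0
hwFuel (suc f) x = x % 2 + hwFuel f (x / 2)

HW : ℕ → ℕ
HW x = hwFuel x x

i′ : ℕ → ℕ → ℕ → ℕ
i′ n l (suc (suc k)) = l ∸ h n (suc k) / 2
i′ n l _             = l

maybeList : {A : Set} → Maybe A → List A
maybeList (Maybe.just a) = a ∷ []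
maybeList Maybe.nothing  = []

AdmissibleSeq : {n : ℕ} → ℕ → ℕ → List (Gate n) → Set
AdmissibleSeq {n} c w gs =
  Data.Product.Σ (List (Gate n)) λ pre → Data.Product.Σ (Maybe (Gate n)) λ mid → Data.Product.Σ (List (Gate n)) λ post →
    (gs ≡ pre ++ maybeList mid ++ post)
    × All IsCNOT pre × All IsCNOT post
    × (length pre + length post ≤ c)
    × All (λ g → ∣ ctrl g ∣ ≤ w) (maybeList mid)

-- A gate that neither targets nor is controlled by the least significant bit moves the two columns
-- 2t, 2t+1 of every block together, so it acts on the block-wise positions t < 2^(n-1); it suffices
-- to find such gates whose action keeps the positions below l below l and sends l to s.
-- Put K = n - m and W = 2^K. The minimality of m places l in one of the last two slabs of width W,
-- 2EW < l ≤ (2E+1)W where 2E + 2 = 2^(m-1), and h_n(m) ≤ 2s places s in the last one. Writing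
-- l = i' + 2EW, the gate CX with the bits of i' as controls and bit K as target sends l to l + W,
-- after which CNOTs controlled by bit K replace the lower bits by those of s. The CX gate moves a
-- position below l up only if its slab index is even and below 2E, and the CNOTs only permute the
-- positions inside a slab of odd index, so positions below l stay below l. If l = (2E+1)W no CX gate
-- is needed; if m = 1 then l = 0, and a NOT on the leading bit of s followed by CNOTs does the job.

module Submission where

open import Data.Bool using (Bool; true; false; not; _∨_; if_then_else_; T)
open import Data.Bool.Properties using (⇔→≡)
open import Data.Empty using (⊥-elim)
open import Data.Fin using (Fin; fromℕ<)
open import Data.Fin.Properties using (toℕ-fromℕ<)
open import Data.Fin.Subset using (Subset; ∣_∣; ⁅_⁆; _∉_)
open import Data.Fin.Subset.Properties using (x∈⁅x⁆; x∈⁅y⁆⇒x≡y; ∣⁅x⁆∣≡1)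
open import Data.List using (List; []; _∷_; map; length; allFin; _++_)
open import Data.List.Membership.Propositional using (_∈_)
open import Data.List.Membership.Propositional.Properties using (∈-allFin)
open import Data.List.Properties using (length-map)
open import Data.List.Relation.Unary.All using (All; []; _∷_)
import Data.List.Relation.Unary.All as All
import Data.List.Relation.Unary.All.Properties as All
open import Data.List.Relation.Unary.Any using (here; there)
open import Data.Maybe using (Maybe; just; nothing)
open import Data.Nat
open import Data.Nat.DivMod
open import Data.Nat.Divisibility using (divides)
open import Data.Nat.Induction using (<-rec)
open import Data.Nat.Properties
open import Data.Nat.Tactic.RingSolver using (solve-∀)
open import Data.Product using (Σ; _×_; _,_)
open import Data.Sum using (_⊎_; inj₁; inj₂)
open import Data.Vec using (lookup; tabulate)
open import Data.Vec.Properties using ([]=⇒lookup; lookup⇒[]=; lookup∘tabulate)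
open import Function using (_∘_; mk⇔)
open import Relation.Binary.PropositionalEquality
open import Relation.Nullary using (¬_; Dec; yes; no)

open import Defs

-- Binary digits

2^k≢0 : ∀ k → NonZero (2 ^ k)
2^k≢0 k = m^n≢0 2 k

infixl 7 _/2^_ _%2^_
_/2^_ _%2^_ : ℕ → ℕ → ℕ
x /2^ k = _/_ x (2 ^ k) {{2^k≢0 k}}
x %2^ k = _%_ x (2 ^ k) {{2^k≢0 k}}

-- Bit e of x has weight 2^e, so testBit n j = bit (weightExp n j) and
-- flipBit n j = flip (weightExp n j) hold by definition.
bit : ℕ → ℕ → Bool
bit e x = shiftR e x % 2 ≡ᵇ 1

flip : ℕ → ℕ → ℕ
flip e x = if bit e x then x ∸ 2 ^ e else x + 2 ^ e

[r+q*d]/d≡q : ∀ q {r d} .{{_ : NonZero d}} → r < d → (r + q * d) / d ≡ q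
[r+q*d]/d≡q q {r} {d} r<d =
  trans (+-distrib-/-∣ʳ r (divides q refl)) (cong₂ _+_ (m<n⇒m/n≡0 r<d) (m*n/n≡m q d))

[r+q*d]%d≡r : ∀ q {r d} .{{_ : NonZero d}} → r < d → (r + q * d) % d ≡ r
[r+q*d]%d≡r q {r} {d} r<d = trans ([m+kn]%n≡m%n r q d) (m<n⇒m%n≡m r<d)

[b+2q]/2≡q : ∀ q {b} → b < 2 → (b + 2 * q) / 2 ≡ q
[b+2q]/2≡q q {b} b<2 = trans (cong (λ z → (b + z) / 2) (*-comm 2 q)) ([r+q*d]/d≡q q b<2)

[b+2q]%2≡b : ∀ q {b} → b < 2 → (b + 2 * q) % 2 ≡ b
[b+2q]%2≡b q {b} b<2 = trans (cong (λ z → (b + z) % 2) (*-comm 2 q)) ([r+q*d]%d≡r q b<2)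

m≡m%2+[m/2]*2 : ∀ x → x ≡ x % 2 + x / 2 * 2
m≡m%2+[m/2]*2 x = m≡m%n+[m/n]*n x 2

m%2≡0⊎m%2≡1 : ∀ x → x % 2 ≡ 0 ⊎ x % 2 ≡ 1
m%2≡0⊎m%2≡1 x with x % 2 | m%n<n x 2
... | 0 | _ = inj₁ refl
... | 1 | _ = inj₂ refl
... | suc (suc _) | s≤s (s≤s ())

%2-≡ᵇ1-true : ∀ y → (y % 2 ≡ᵇ 1) ≡ true → y % 2 ≡ 1
%2-≡ᵇ1-true y eq with m%2≡0⊎m%2≡1 y
... | inj₂ odd = odd
... | inj₁ even with () ← trans (sym eq) (cong (_≡ᵇ 1) even)

%2-≡ᵇ1-false : ∀ y → (y % 2 ≡ᵇ 1) ≡ false → y % 2 ≡ 0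
%2-≡ᵇ1-false y eq with m%2≡0⊎m%2≡1 y
... | inj₁ even = even
... | inj₂ odd with () ← trans (sym eq) (cong (_≡ᵇ 1) odd)

shiftR≡/2^ : ∀ k x → shiftR k x ≡ x /2^ k
shiftR≡/2^ zero x = sym (n/1≡n x)
shiftR≡/2^ (suc k) x =
  trans (shiftR≡/2^ k (x / 2)) (m/n/o≡m/[n*o] x 2 (2 ^ k) {{_}} {{2^k≢0 k}} {{2^k≢0 (suc k)}})

/2^-suc : ∀ k x → x /2^ suc k ≡ x / 2 /2^ k
/2^-suc k x = trans (sym (shiftR≡/2^ (suc k) x)) (shiftR≡/2^ k (x / 2))

bit-/2^ : ∀ k x → bit k x ≡ (x /2^ k % 2 ≡ᵇ 1)
bit-/2^ k x = cong (λ y → y % 2 ≡ᵇ 1) (shiftR≡/2^ k x)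

bit-cong : ∀ k {x y} → x /2^ k ≡ y /2^ k → bit k x ≡ bit k y
bit-cong k {x} {y} eq = trans (bit-/2^ k x) (trans (cong (λ z → z % 2 ≡ᵇ 1) eq) (sym (bit-/2^ k y)))

bit-true : ∀ k x → bit k x ≡ true → x /2^ k % 2 ≡ 1
bit-true k x eq = %2-≡ᵇ1-true (x /2^ k) (trans (sym (bit-/2^ k x)) eq)

bit-false : ∀ k x → bit k x ≡ false → x /2^ k % 2 ≡ 0
bit-false k x eq = %2-≡ᵇ1-false (x /2^ k) (trans (sym (bit-/2^ k x)) eq)

bit-< : ∀ e {x} → x < 2 ^ e → bit e x ≡ false
bit-< e {x} lt = trans (bit-/2^ e x) (cong (λ y → y % 2 ≡ᵇ 1) (m<n⇒m/n≡0 {{2^k≢0 e}} lt))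

bit⇒2^≤ : ∀ e x → bit e x ≡ true → 2 ^ e ≤ x
bit⇒2^≤ e x eq = m/n≢0⇒n≤m {{2^k≢0 e}} λ x/2^e≡0 →
  0≢1+n (trans (cong (_% 2) (sym x/2^e≡0)) (bit-true e x eq))

bit⇒< : ∀ {N} e x → x < 2 ^ N → bit e x ≡ true → e < N
bit⇒< {N} e x x<2^N bite = ≰⇒> λ N≤e →
  <-irrefl refl (<-≤-trans x<2^N (≤-trans (^-monoʳ-≤ 2 N≤e) (bit⇒2^≤ e x bite)))

flip-true : ∀ e x → bit e x ≡ true → flip e x ≡ x ∸ 2 ^ e
flip-true e x eq = cong (λ b → if b then x ∸ 2 ^ e else x + 2 ^ e) eq

flip-false : ∀ e x → bit e x ≡ false → flip e x ≡ x + 2 ^ e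
flip-false e x eq = cong (λ b → if b then x ∸ 2 ^ e else x + 2 ^ e) eq

flip-suc : ∀ e x → flip (suc e) x ≡ x % 2 + flip e (x / 2) * 2
flip-suc e x with bit e (x / 2) in eq
... | true = begin
  x ∸ 2 * 2 ^ e                       ≡⟨ cong (_∸ 2 * 2 ^ e) (m≡m%2+[m/2]*2 x) ⟩
  x % 2 + x / 2 * 2 ∸ 2 * 2 ^ e       ≡⟨ +-∸-assoc (x % 2) 2^e*2≤ ⟩
  x % 2 + (x / 2 * 2 ∸ 2 * 2 ^ e)     ≡⟨ cong (λ z → x % 2 + (x / 2 * 2 ∸ z)) (*-comm 2 (2 ^ e)) ⟩
  x % 2 + (x / 2 * 2 ∸ 2 ^ e * 2)     ≡⟨ cong (x % 2 +_) (*-distribʳ-∸ 2 (x / 2) (2 ^ e)) ⟨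
  x % 2 + (x / 2 ∸ 2 ^ e) * 2         ∎
  where
    open ≡-Reasoning
    2^e*2≤ : 2 * 2 ^ e ≤ x / 2 * 2
    2^e*2≤ = subst (_≤ x / 2 * 2) (*-comm (2 ^ e) 2) (*-monoˡ-≤ 2 (bit⇒2^≤ e (x / 2) eq))
... | false = begin
  x + 2 * 2 ^ e                       ≡⟨ cong (_+ 2 * 2 ^ e) (m≡m%2+[m/2]*2 x) ⟩
  x % 2 + x / 2 * 2 + 2 * 2 ^ e       ≡⟨ regroup (x % 2) (x / 2) (2 ^ e) ⟩
  x % 2 + (x / 2 + 2 ^ e) * 2         ∎
  where
    open ≡-Reasoning
    regroup : ∀ a b c → a + b * 2 + 2 * c ≡ a + (b + c) * 2
    regroup = solve-∀

flip-suc-/2 : ∀ e x → flip (suc e) x / 2 ≡ flip e (x / 2)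
flip-suc-/2 e x = trans (cong (_/ 2) (flip-suc e x)) ([r+q*d]/d≡q (flip e (x / 2)) (m%n<n x 2))

flip-0-/2 : ∀ x → flip 0 x / 2 ≡ x / 2
flip-0-/2 x with m%2≡0⊎m%2≡1 x
... | inj₁ even = begin
  flip 0 x / 2                 ≡⟨ cong (_/ 2) (flip-false 0 x (cong (_≡ᵇ 1) even)) ⟩
  (x + 1) / 2                  ≡⟨ cong (λ z → (z + 1) / 2) (m≡m%2+[m/2]*2 x) ⟩
  (x % 2 + x / 2 * 2 + 1) / 2  ≡⟨ cong (λ z → (z + x / 2 * 2 + 1) / 2) even ⟩
  (x / 2 * 2 + 1) / 2          ≡⟨ cong (_/ 2) (+-comm (x / 2 * 2) 1) ⟩
  (1 + x / 2 * 2) / 2          ≡⟨ [r+q*d]/d≡q (x / 2) (s≤s (s≤s z≤n)) ⟩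
  x / 2                        ∎
  where open ≡-Reasoning
... | inj₂ odd = begin
  flip 0 x / 2                 ≡⟨ cong (_/ 2) (flip-true 0 x (cong (_≡ᵇ 1) odd)) ⟩
  (x ∸ 1) / 2                  ≡⟨ cong (λ z → (z ∸ 1) / 2) (m≡m%2+[m/2]*2 x) ⟩
  (x % 2 + x / 2 * 2 ∸ 1) / 2  ≡⟨ cong (λ z → (z + x / 2 * 2 ∸ 1) / 2) odd ⟩
  (0 + x / 2 * 2) / 2          ≡⟨ [r+q*d]/d≡q (x / 2) (s≤s z≤n) ⟩
  x / 2                        ∎
  where open ≡-Reasoning

flip-/2^ : ∀ {e K} x → e < K → flip e x /2^ K ≡ x /2^ K
flip-/2^ {zero} {suc K} x _ = begin
  flip 0 x /2^ suc K      ≡⟨ /2^-suc K (flip 0 x) ⟩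
  flip 0 x / 2 /2^ K      ≡⟨ cong (_/2^ K) (flip-0-/2 x) ⟩
  x / 2 /2^ K             ≡⟨ /2^-suc K x ⟨
  x /2^ suc K             ∎
  where open ≡-Reasoning
flip-/2^ {suc e} {suc K} x (s≤s e<K) = begin
  flip (suc e) x /2^ suc K  ≡⟨ /2^-suc K (flip (suc e) x) ⟩
  flip (suc e) x / 2 /2^ K  ≡⟨ cong (_/2^ K) (flip-suc-/2 e x) ⟩
  flip e (x / 2) /2^ K      ≡⟨ flip-/2^ (x / 2) e<K ⟩
  x / 2 /2^ K               ≡⟨ /2^-suc K x ⟨
  x /2^ suc K               ∎
  where open ≡-Reasoning

flips : List ℕ → ℕ → ℕ
flips []       x = x
flips (e ∷ es) x = flip e (flips es x)

flips-/2^ : ∀ {K} es x → All (_< K) es → flips es x /2^ K ≡ x /2^ K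
flips-/2^ []       x []         = refl
flips-/2^ (e ∷ es) x (e<K ∷ p) = trans (flip-/2^ (flips es x) e<K) (flips-/2^ es x p)

flips-map-suc : ∀ es x → flips (map suc es) x ≡ x % 2 + flips es (x / 2) * 2
flips-map-suc []       x = m≡m%2+[m/2]*2 x
flips-map-suc (e ∷ es) x = begin
  flip (suc e) (flips (map suc es) x)    ≡⟨ cong (flip (suc e)) (flips-map-suc es x) ⟩
  flip (suc e) y                         ≡⟨ flip-suc e y ⟩
  y % 2 + flip e (y / 2) * 2             ≡⟨ cong₂ (λ a b → a + flip e b * 2) ([r+q*d]%d≡r q x%2<2)
                                                                           ([r+q*d]/d≡q q x%2<2) ⟩
  x % 2 + flip e q * 2                   ∎
  where
    open ≡-Reasoning
    q = flips es (x / 2)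
    y = x % 2 + q * 2
    x%2<2 = m%n<n x 2

diffBits : ℕ → ℕ → ℕ → List ℕ
diffBits zero    r s = []
diffBits (suc k) r s = if r % 2 ≡ᵇ s % 2 then upper else 0 ∷ upper
  where upper = map suc (diffBits k (r / 2) (s / 2))

length-diffBits : ∀ k r s → length (diffBits k r s) ≤ k
length-diffBits zero    r s = z≤n
length-diffBits (suc k) r s with r % 2 ≡ᵇ s % 2
... | true  = m≤n⇒m≤1+n (≤-trans (≤-reflexive (length-map suc (diffBits k (r / 2) (s / 2))))
                                    (length-diffBits k (r / 2) (s / 2)))
... | false = s≤s (≤-trans (≤-reflexive (length-map suc (diffBits k (r / 2) (s / 2))))
                           (length-diffBits k (r / 2) (s / 2)))

diffBits-< : ∀ k r s → All (_< k) (diffBits k r s)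
diffBits-< zero    r s = []
diffBits-< (suc k) r s with r % 2 ≡ᵇ s % 2
... | true  = All.map⁺ (All.map s≤s (diffBits-< k (r / 2) (s / 2)))
... | false = z<s ∷ All.map⁺ (All.map s≤s (diffBits-< k (r / 2) (s / 2)))

≡-by-%2-/2 : ∀ {x y} → x % 2 ≡ y % 2 → x / 2 ≡ y / 2 → x ≡ y
≡-by-%2-/2 {x} {y} eq₁ eq₂ = begin
  x                  ≡⟨ m≡m%2+[m/2]*2 x ⟩
  x % 2 + x / 2 * 2  ≡⟨ cong₂ (λ a q → a + q * 2) eq₁ eq₂ ⟩
  y % 2 + y / 2 * 2  ≡⟨ m≡m%2+[m/2]*2 y ⟨
  y                  ∎
  where open ≡-Reasoning

flip-0-even : ∀ q → flip 0 (q * 2) ≡ 1 + q * 2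
flip-0-even q = trans (flip-false 0 (q * 2) (cong (_≡ᵇ 1) (m*n%n≡0 q 2))) (+-comm (q * 2) 1)

flip-0-odd : ∀ q → flip 0 (1 + q * 2) ≡ q * 2
flip-0-odd q = flip-true 0 (1 + q * 2) (cong (_≡ᵇ 1) ([r+q*d]%d≡r q (s≤s (s≤s z≤n))))

flip-0-other-parity : ∀ {y s} → y / 2 ≡ s / 2 → (y % 2 ≡ᵇ s % 2) ≡ false → flip 0 y ≡ s
flip-0-other-parity {y} {s} y/2≡s/2 differ
  with m%2≡0⊎m%2≡1 y | m%2≡0⊎m%2≡1 s
... | inj₁ y-even | inj₁ s-even with () ← trans (sym differ) (cong₂ _≡ᵇ_ y-even s-even)
... | inj₂ y-odd  | inj₂ s-odd  with () ← trans (sym differ) (cong₂ _≡ᵇ_ y-odd s-odd)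
... | inj₁ y-even | inj₂ s-odd = begin
  flip 0 y                    ≡⟨ cong (flip 0) (m≡m%2+[m/2]*2 y) ⟩
  flip 0 (y % 2 + y / 2 * 2)  ≡⟨ cong₂ (λ a q → flip 0 (a + q * 2)) y-even y/2≡s/2 ⟩
  flip 0 (s / 2 * 2)          ≡⟨ flip-0-even (s / 2) ⟩
  1 + s / 2 * 2               ≡⟨ cong (_+ s / 2 * 2) s-odd ⟨
  s % 2 + s / 2 * 2           ≡⟨ m≡m%2+[m/2]*2 s ⟨
  s                           ∎
  where open ≡-Reasoning
... | inj₂ y-odd  | inj₁ s-even = begin
  flip 0 y                    ≡⟨ cong (flip 0) (m≡m%2+[m/2]*2 y) ⟩
  flip 0 (y % 2 + y / 2 * 2)  ≡⟨ cong₂ (λ a q → flip 0 (a + q * 2)) y-odd y/2≡s/2 ⟩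
  flip 0 (1 + s / 2 * 2)      ≡⟨ flip-0-odd (s / 2) ⟩
  s / 2 * 2                   ≡⟨ cong (_+ s / 2 * 2) s-even ⟨
  s % 2 + s / 2 * 2           ≡⟨ m≡m%2+[m/2]*2 s ⟨
  s                           ∎
  where open ≡-Reasoning

flips-diffBits : ∀ k r s → r /2^ k ≡ s /2^ k → flips (diffBits k r s) r ≡ s
flips-diffBits zero    r s eq = trans (sym (n/1≡n r)) (trans eq (n/1≡n s))
flips-diffBits (suc k) r s eq = finish (r % 2 ≡ᵇ s % 2) refl
  where
    upper = map suc (diffBits k (r / 2) (s / 2))
    y = flips upper r
    y≡ : y ≡ r % 2 + s / 2 * 2
    y≡ = trans (flips-map-suc (diffBits k (r / 2) (s / 2)) r) (cong (λ z → r % 2 + z * 2)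
      (flips-diffBits k (r / 2) (s / 2) (trans (sym (/2^-suc k r)) (trans eq (/2^-suc k s)))))
    y%2 : y % 2 ≡ r % 2
    y%2 = trans (cong (_% 2) y≡) ([r+q*d]%d≡r (s / 2) (m%n<n r 2))
    y/2 : y / 2 ≡ s / 2
    y/2 = trans (cong (_/ 2) y≡) ([r+q*d]/d≡q (s / 2) (m%n<n r 2))
    finish : ∀ b → (r % 2 ≡ᵇ s % 2) ≡ b → flips (if b then upper else 0 ∷ upper) r ≡ s
    finish true  same   = ≡-by-%2-/2 (trans y%2 (≡ᵇ⇒≡ (r % 2) (s % 2) (subst T (sym same) _))) y/2
    finish false differ = flip-0-other-parity {y} y/2 (trans (cong (_≡ᵇ s % 2) y%2) differ)

bit-%2^ : ∀ {e K} x → e < K → bit e (x %2^ K) ≡ bit e x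
bit-%2^ {zero} {suc K} x _ =
  cong (_≡ᵇ 1) (m∣n⇒o%n%m≡o%m 2 (2 ^ suc K) x {{_}} {{2^k≢0 (suc K)}}
                               (divides (2 ^ K) (*-comm 2 (2 ^ K))))
bit-%2^ {suc e} {suc K} x (s≤s e<K) = trans (cong (bit e) x%2^K+1/2≡) (bit-%2^ (x / 2) e<K)
  where
    instance
      2^K*2≢0 : NonZero (2 ^ K * 2)
      2^K*2≢0 = m*n≢0 (2 ^ K) 2 {{2^k≢0 K}}
    x%2^K+1/2≡ : x %2^ suc K / 2 ≡ x / 2 %2^ K
    x%2^K+1/2≡ = trans (cong (_/ 2) (%-congʳ {o = x} {{2^k≢0 (suc K)}} (*-comm 2 (2 ^ K))))
                       (m%[n*o]/o≡m/o%n x (2 ^ K) 2 {{2^k≢0 K}})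

BitsSubset : ℕ → ℕ → Set
BitsSubset a b = ∀ e → bit e a ≡ true → bit e b ≡ true

bits⊆⇒≤ : ∀ a b → BitsSubset a b → a ≤ b
bits⊆⇒≤ = <-rec _ go
  where
    go : ∀ a → (∀ {a′} → a′ < a → ∀ b → BitsSubset a′ b → a′ ≤ b) → ∀ b → BitsSubset a b → a ≤ b
    go zero      _  b _ = z≤n
    go a@(suc _) ih b a⊆b = begin
      a                  ≡⟨ m≡m%2+[m/2]*2 a ⟩
      a % 2 + a / 2 * 2  ≤⟨ +-mono-≤ low (*-monoˡ-≤ 2 (ih (m/n<m a 2 (s≤s z<s)) (b / 2) (a⊆b ∘ suc))) ⟩
      b % 2 + b / 2 * 2  ≡⟨ m≡m%2+[m/2]*2 b ⟨
      b                  ∎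
      where
        open ≤-Reasoning
        low : a % 2 ≤ b % 2
        low with m%2≡0⊎m%2≡1 a
        ... | inj₁ a-even = subst (_≤ b % 2) (sym a-even) z≤n
        ... | inj₂ a-odd  = ≤-reflexive (trans a-odd (sym (%2-≡ᵇ1-true b (a⊆b 0 (cong (_≡ᵇ 1) a-odd)))))

allB⇒ : ∀ {A : Set} (p : A → Bool) xs {a} → allB p xs ≡ true → a ∈ xs → p a ≡ true
allB⇒ p (x ∷ xs) eq a∈ with p x in px
allB⇒ p (x ∷ xs) eq (here refl) | true = px
allB⇒ p (x ∷ xs) eq (there a∈)  | true = allB⇒ p xs eq a∈
allB⇒ p (x ∷ xs) () a∈          | false

allB⇐ : ∀ {A : Set} (p : A → Bool) xs → (∀ a → p a ≡ true) → allB p xs ≡ true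
allB⇐ p []       all-p = refl
allB⇐ p (x ∷ xs) all-p rewrite all-p x = allB⇐ p xs all-p

controlsOn⇒ : ∀ n I x j → controlsOn n I x ≡ true → lookup I j ≡ true → testBit n j x ≡ true
controlsOn⇒ n I x j on j∈I
  with allB⇒ (λ j → not (lookup I j) ∨ testBit n j x) (allFin n) on (∈-allFin j)
... | holds rewrite j∈I = holds

controlsOn⇐ : ∀ n I x → (∀ j → lookup I j ≡ true → testBit n j x ≡ true) →
              controlsOn n I x ≡ true
controlsOn⇐ n I x set = allB⇐ _ (allFin n) holds
  where
    holds : ∀ j → not (lookup I j) ∨ testBit n j x ≡ true
    holds j with lookup I j in j∈I
    ... | true  = set j j∈I
    ... | false = refl

controlsOn-cong : ∀ n I {x y} → (∀ j → lookup I j ≡ true → testBit n j x ≡ testBit n j y) →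
                  controlsOn n I x ≡ controlsOn n I y
controlsOn-cong n I {x} {y} same = ⇔→≡ (mk⇔
  (λ on → controlsOn⇐ n I y λ j j∈I → trans (sym (same j j∈I)) (controlsOn⇒ n I x j on j∈I))
  (λ on → controlsOn⇐ n I x λ j j∈I → trans (same j j∈I) (controlsOn⇒ n I y j on j∈I)))

-- Block-wise gates

bitPos : ∀ {N} e → e < N → Fin (suc N)
bitPos {N} e _ = fromℕ< {N ∸ suc e} (s≤s (m∸n≤m N (suc e)))

weightExp-bitPos : ∀ {N e} (e<N : e < N) → weightExp (suc N) (bitPos e e<N) ≡ suc e
weightExp-bitPos {N} {e} e<N =
  trans (cong (N ∸_) (toℕ-fromℕ< (s≤s (m∸n≤m N (suc e))))) (m∸[m∸n]≡n e<N)

testBit-bitPos : ∀ {N e} (e<N : e < N) y → testBit (suc N) (bitPos e e<N) y ≡ bit (suc e) y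
testBit-bitPos e<N y = cong (λ w → bit w y) (weightExp-bitPos e<N)

IsBlockwise : ∀ {n} → Gate n → Set
IsBlockwise {n} g = weightExp n (tgt g) ≢ 0 × (∀ j → lookup (ctrl g) j ≡ true → weightExp n j ≢ 0)

blockMap : ∀ {n} → Gate n → ℕ → ℕ
blockMap {n} g t = if controlsOn n (ctrl g) (2 * t) then flip (pred (weightExp n (tgt g))) t else t

blockMaps : ∀ {n} → List (Gate n) → ℕ → ℕ
blockMaps []       t = t
blockMaps (g ∷ gs) t = blockMap g (blockMaps gs t)

blockMaps-++ : ∀ {n} (gs hs : List (Gate n)) t → blockMaps (gs ++ hs) t ≡ blockMaps gs (blockMaps hs t)
blockMaps-++ []       hs t = refl
blockMaps-++ (g ∷ gs) hs t = cong (blockMap g) (blockMaps-++ gs hs t)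

bit-suc-block : ∀ e t {b} → b < 2 → bit (suc e) (b + 2 * t) ≡ bit e t
bit-suc-block e t b<2 = cong (bit e) ([b+2q]/2≡q t b<2)

flip-suc-block : ∀ e t {b} → b < 2 → flip (suc e) (b + 2 * t) ≡ b + 2 * flip e t
flip-suc-block e t {b} b<2 = begin
  flip (suc e) (b + 2 * t)                        ≡⟨ flip-suc e (b + 2 * t) ⟩
  (b + 2 * t) % 2 + flip e ((b + 2 * t) / 2) * 2  ≡⟨ cong₂ (λ a q → a + flip e q * 2) ([b+2q]%2≡b t b<2)
                                                                                       ([b+2q]/2≡q t b<2) ⟩
  b + flip e t * 2                                ≡⟨ cong (b +_) (*-comm (flip e t) 2) ⟩
  b + 2 * flip e t                                ∎
  where open ≡-Reasoning

controlsOn-block : ∀ n I t {b} → (∀ j → lookup I j ≡ true → weightExp n j ≢ 0) → b < 2 →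
                   controlsOn n I (b + 2 * t) ≡ controlsOn n I (2 * t)
controlsOn-block n I t {b} ctrl≢0 b<2 = controlsOn-cong n I same
  where
    same : ∀ j → lookup I j ≡ true → testBit n j (b + 2 * t) ≡ testBit n j (2 * t)
    same j j∈I with weightExp n j in w≡
    ... | zero  = ⊥-elim (ctrl≢0 j j∈I w≡)
    ... | suc w = trans (bit-suc-block w t b<2) (sym (bit-suc-block w t z<s))

gateFun-block : ∀ {n} (g : Gate n) t {b} → IsBlockwise g → b < 2 →
                gateFun g (b + 2 * t) ≡ b + 2 * blockMap g t
gateFun-block {n} g t {b} (tgt≢0 , ctrl≢0) b<2 rewrite controlsOn-block n (ctrl g) t ctrl≢0 b<2
  with controlsOn n (ctrl g) (2 * t) | weightExp n (tgt g)
... | false | _     = refl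
... | true  | zero  = ⊥-elim (tgt≢0 refl)
... | true  | suc w = flip-suc-block w t b<2

applyGates-block : ∀ {n} P (gs : List (Gate n)) t {b} → All IsBlockwise gs → b < 2 →
                   applyGates P gs (b + 2 * t) ≡ P (b + 2 * blockMaps gs t)
applyGates-block P []       t []           b<2 = refl
applyGates-block P (g ∷ gs) t (g-bw ∷ gs-bw) b<2 =
  trans (applyGates-block (applyGate P g) gs t gs-bw b<2) (cong P (gateFun-block g (blockMaps gs t) g-bw b<2))

bit-0-double : ∀ y → bit 0 (2 * y) ≡ false
bit-0-double y = cong (_≡ᵇ 1) ([b+2q]%2≡b y {0} z<s)

bit-suc-double : ∀ e y → bit (suc e) (2 * y) ≡ bit e y
bit-suc-double e y = bit-suc-block e y {0} z<s

CNOT : ∀ {N c e} → e < c → c < N → Gate (suc N)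
CNOT {N} {c} {e} e<c c<N = CX ⁅ bitPos c c<N ⁆ (bitPos e (<-trans e<c c<N)) e∉⁅c⁆
  where
    e∉⁅c⁆ : bitPos e (<-trans e<c c<N) ∉ ⁅ bitPos c c<N ⁆
    e∉⁅c⁆ e∈ = <-irrefl (suc-injective (begin
      suc e                                 ≡⟨ weightExp-bitPos e<N ⟨
      weightExp (suc N) (bitPos e e<N)      ≡⟨ cong (weightExp (suc N)) (x∈⁅y⁆⇒x≡y _ e∈) ⟩
      weightExp (suc N) (bitPos c c<N)      ≡⟨ weightExp-bitPos c<N ⟩
      suc c                                 ∎)) e<c
      where
        open ≡-Reasoning
        e<N = <-trans e<c c<N

controlsOn-⁅⁆ : ∀ n p x → controlsOn n ⁅ p ⁆ x ≡ testBit n p x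
controlsOn-⁅⁆ n p x = ⇔→≡ {z = true} (mk⇔
  (λ on → controlsOn⇒ n ⁅ p ⁆ x p on ([]=⇒lookup (x∈⁅x⁆ p)))
  (λ set → controlsOn⇐ n ⁅ p ⁆ x λ j j∈ →
    subst (λ k → testBit n k x ≡ true) (sym (x∈⁅y⁆⇒x≡y p (lookup⇒[]= j _ j∈))) set))

blockMap-CNOT : ∀ {N c e} (e<c : e < c) (c<N : c < N) t →
                blockMap (CNOT e<c c<N) t ≡ (if bit c t then flip e t else t)
blockMap-CNOT {N} {c} e<c c<N t = cong₂ (λ b w → if b then flip w t else t)
  (trans (controlsOn-⁅⁆ (suc N) (bitPos c c<N) (2 * t))
         (trans (testBit-bitPos c<N (2 * t)) (bit-suc-double c t)))
  (cong pred (weightExp-bitPos (<-trans e<c c<N)))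

CNOT-blockwise : ∀ {N c e} (e<c : e < c) (c<N : c < N) → IsBlockwise (CNOT e<c c<N)
CNOT-blockwise {N} {c} e<c c<N =
  (λ w≡0 → 0≢1+n (trans (sym w≡0) (weightExp-bitPos (<-trans e<c c<N)))) ,
  (λ j j∈ w≡0 → 0≢1+n (trans (sym w≡0) (trans
     (cong (weightExp (suc N)) (x∈⁅y⁆⇒x≡y (bitPos c c<N) (lookup⇒[]= j _ j∈)))
     (weightExp-bitPos c<N))))

bitSet : ∀ n → ℕ → Subset n
bitSet n y = tabulate (λ j → testBit n j y)

-- the bits of the block-wise position i, shifted past the least significant bit
blockControls : ∀ N → ℕ → Subset (suc N)
blockControls N i = bitSet (suc N) (2 * i)

testBit-blockControls : ∀ N i j → lookup (blockControls N i) j ≡ true →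
                        Σ ℕ λ e → weightExp (suc N) j ≡ suc e × bit e i ≡ true
testBit-blockControls N i j j∈
  with weightExp (suc N) j | trans (sym (lookup∘tabulate (λ j → testBit (suc N) j (2 * i)) j)) j∈
... | zero  | bit0 with () ← trans (sym (bit-0-double i)) bit0
... | suc e | bite = e , refl , trans (sym (bit-suc-double e i)) bite

CXbits : ∀ {N K} i → K < N → i < 2 ^ K → Gate (suc N)
CXbits {N} {K} i K<N i<2^K = CX (blockControls N i) (bitPos K K<N) K∉
  where
    K∉ : bitPos K K<N ∉ blockControls N i
    K∉ K∈ with testBit-blockControls N i (bitPos K K<N) ([]=⇒lookup K∈)
    ... | e , w≡ , bite with refl ← trans (sym (weightExp-bitPos K<N)) w≡ =
      <-irrefl refl (bit⇒< K i i<2^K bite)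

CXbits-blockwise : ∀ {N K} i (K<N : K < N) (i<2^K : i < 2 ^ K) → IsBlockwise (CXbits i K<N i<2^K)
CXbits-blockwise {N} i K<N i<2^K =
  (λ w≡0 → 0≢1+n (trans (sym w≡0) (weightExp-bitPos K<N))) ,
  (λ j j∈ w≡0 → let (_ , w≡ , _) = testBit-blockControls N i j j∈ in 0≢1+n (trans (sym w≡0) w≡))

controlsOn-blockControls⇐ : ∀ N i t → BitsSubset i t →
                     controlsOn (suc N) (blockControls N i) (2 * t) ≡ true
controlsOn-blockControls⇐ N i t i⊆t = controlsOn⇐ (suc N) (blockControls N i) (2 * t) λ j j∈ →
  let (e , w≡ , bite) = testBit-blockControls N i j j∈ in
  trans (cong (λ w → bit w (2 * t)) w≡) (trans (bit-suc-double e t) (i⊆t e bite))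

controlsOn-blockControls⇒ : ∀ N i t → i < 2 ^ N → controlsOn (suc N) (blockControls N i) (2 * t) ≡ true →
                     BitsSubset i t
controlsOn-blockControls⇒ N i t i<2^N on e bite = begin
  bit e t                  ≡⟨ bit-suc-double e t ⟨
  bit (suc e) (2 * t)      ≡⟨ testBit-bitPos e<N (2 * t) ⟨
  testBit (suc N) j (2 * t)  ≡⟨ controlsOn⇒ (suc N) (blockControls N i) (2 * t) j on e∈ ⟩
  true                     ∎
  where
    open ≡-Reasoning
    e<N = bit⇒< e i i<2^N bite
    j = bitPos e e<N
    e∈ : lookup (blockControls N i) j ≡ true
    e∈ = trans (lookup∘tabulate (λ j → testBit (suc N) j (2 * i)) j)
               (trans (testBit-bitPos e<N (2 * i)) (trans (bit-suc-double e i) bite))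

blockMap-CXbits : ∀ {N K} i (K<N : K < N) (i<2^K : i < 2 ^ K) t →
  blockMap (CXbits i K<N i<2^K) t ≡ (if controlsOn (suc N) (blockControls N i) (2 * t) then flip K t else t)
blockMap-CXbits {N} i K<N i<2^K t =
  cong (λ w → if controlsOn (suc N) (blockControls N i) (2 * t) then flip w t else t)
       (cong pred (weightExp-bitPos K<N))

bitValue : Bool → ℕ
bitValue true  = 1
bitValue false = 0

∣bitSet-suc∣ : ∀ n y → ∣ bitSet (suc n) y ∣ ≡ bitValue (bit n y) + ∣ bitSet n y ∣
∣bitSet-suc∣ n y with bit n y
... | true  = refl
... | false = refl

∣bitSet-suc∣-lsb : ∀ n y → ∣ bitSet (suc n) y ∣ ≡ bitValue (bit 0 y) + ∣ bitSet n (y / 2) ∣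
∣bitSet-suc∣-lsb zero    y = ∣bitSet-suc∣ zero y
∣bitSet-suc∣-lsb (suc n) y = begin
  ∣ bitSet (suc (suc n)) y ∣       ≡⟨ ∣bitSet-suc∣ (suc n) y ⟩
  b + ∣ bitSet (suc n) y ∣         ≡⟨ cong (b +_) (∣bitSet-suc∣-lsb n y) ⟩
  b + (b₀ + ∣ bitSet n (y / 2) ∣)  ≡⟨ +-comm-middle b b₀ _ ⟩
  b₀ + (b + ∣ bitSet n (y / 2) ∣)  ≡⟨ cong (b₀ +_) (∣bitSet-suc∣ n (y / 2)) ⟨
  b₀ + ∣ bitSet (suc n) (y / 2) ∣  ∎
  where
    open ≡-Reasoning
    b = bitValue (bit (suc n) y)
    b₀ = bitValue (bit 0 y)
    +-comm-middle : ∀ a c d → a + (c + d) ≡ c + (a + d)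
    +-comm-middle = solve-∀

∣bitSet-0∣ : ∀ n → ∣ bitSet n 0 ∣ ≡ 0
∣bitSet-0∣ zero    = refl
∣bitSet-0∣ (suc n) =
  trans (∣bitSet-suc∣ n 0) (cong₂ (λ b c → bitValue b + c) (bit-< n (m^n>0 2 n)) (∣bitSet-0∣ n))

bitValue-bit-0 : ∀ y → bitValue (bit 0 y) ≡ y % 2
bitValue-bit-0 y with m%2≡0⊎m%2≡1 y
... | inj₁ even = trans (cong (λ z → bitValue (z ≡ᵇ 1)) even) (sym even)
... | inj₂ odd  = trans (cong (λ z → bitValue (z ≡ᵇ 1)) odd) (sym odd)

∣bitSet∣≤hwFuel : ∀ f n y → y < 2 ^ f → ∣ bitSet n y ∣ ≤ hwFuel f y
∣bitSet∣≤hwFuel f       zero    y       _    = z≤n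
∣bitSet∣≤hwFuel zero    (suc n) zero    _    = ≤-reflexive (∣bitSet-0∣ (suc n))
∣bitSet∣≤hwFuel zero    (suc n) (suc y) (s≤s ())
∣bitSet∣≤hwFuel (suc f) (suc n) y       y<2^f = begin
  ∣ bitSet (suc n) y ∣                      ≡⟨ ∣bitSet-suc∣-lsb n y ⟩
  bitValue (bit 0 y) + ∣ bitSet n (y / 2) ∣  ≤⟨ +-mono-≤ (≤-reflexive (bitValue-bit-0 y))
                                                         (∣bitSet∣≤hwFuel f n (y / 2) y/2<2^f) ⟩
  y % 2 + hwFuel f (y / 2)                  ∎
  where
    open ≤-Reasoning
    y/2<2^f : y / 2 < 2 ^ f
    y/2<2^f = m<n*o⇒m/o<n (subst (y <_) (*-comm 2 (2 ^ f)) y<2^f)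

n<2^n : ∀ n → n < 2 ^ n
n<2^n zero    = z<s
n<2^n (suc n) =
  subst (suc (suc n) ≤_) (cong (2 ^ n +_) (sym (+-identityʳ (2 ^ n)))) (+-mono-≤ (m^n>0 2 n) (n<2^n n))

∣blockControls∣≤HW : ∀ n i → ∣ blockControls n i ∣ ≤ HW i
∣blockControls∣≤HW n i = begin
  ∣ blockControls n i ∣                                    ≡⟨ ∣bitSet-suc∣-lsb n (2 * i) ⟩
  bitValue (bit 0 (2 * i)) + ∣ bitSet n (2 * i / 2) ∣      ≡⟨ cong₂ (λ b y → bitValue b + ∣ bitSet n y ∣)
                                                                    (bit-0-double i) ([b+2q]/2≡q i {0} z<s) ⟩
  ∣ bitSet n i ∣                                           ≤⟨ ∣bitSet∣≤hwFuel i n i (n<2^n i) ⟩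
  HW i                                                     ∎
  where open ≤-Reasoning

-- Circuits on block-wise positions

cnotsFrom : ∀ {N K} → K < N → (es : List ℕ) → All (_< K) es → List (Gate (suc N))
cnotsFrom K<N []       []           = []
cnotsFrom K<N (e ∷ es) (e<K ∷ es<K) = CNOT e<K K<N ∷ cnotsFrom K<N es es<K

length-cnotsFrom : ∀ {N K} (K<N : K < N) es es<K → length (cnotsFrom K<N es es<K) ≡ length es
length-cnotsFrom K<N []       []           = refl
length-cnotsFrom K<N (e ∷ es) (e<K ∷ es<K) = cong suc (length-cnotsFrom K<N es es<K)

cnotsFrom-CNOT : ∀ {N K} (K<N : K < N) es es<K → All IsCNOT (cnotsFrom K<N es es<K)
cnotsFrom-CNOT {N} {K} K<N []       []           = []
cnotsFrom-CNOT {N} {K} K<N (e ∷ es) (e<K ∷ es<K) = ∣⁅x⁆∣≡1 (bitPos K K<N) ∷ cnotsFrom-CNOT K<N es es<K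

cnotsFrom-blockwise : ∀ {N K} (K<N : K < N) es es<K → All IsBlockwise (cnotsFrom K<N es es<K)
cnotsFrom-blockwise K<N []       []           = []
cnotsFrom-blockwise K<N (e ∷ es) (e<K ∷ es<K) = CNOT-blockwise e<K K<N ∷ cnotsFrom-blockwise K<N es es<K

blockMaps-cnotsFrom-on : ∀ {N K} (K<N : K < N) es es<K x → bit K x ≡ true →
                         blockMaps (cnotsFrom K<N es es<K) x ≡ flips es x
blockMaps-cnotsFrom-on K<N []       []           x on = refl
blockMaps-cnotsFrom-on {K = K} K<N (e ∷ es) (e<K ∷ es<K) x on = begin
  blockMap (CNOT e<K K<N) (blockMaps (cnotsFrom K<N es es<K) x)
    ≡⟨ cong (blockMap (CNOT e<K K<N)) (blockMaps-cnotsFrom-on K<N es es<K x on) ⟩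
  blockMap (CNOT e<K K<N) y
    ≡⟨ blockMap-CNOT e<K K<N y ⟩
  (if bit K y then flip e y else y)
    ≡⟨ cong (λ b → if b then flip e y else y) (trans (bit-cong K (flips-/2^ es x es<K)) on) ⟩
  flip e y
    ∎
  where
    open ≡-Reasoning
    y = flips es x

blockMaps-cnotsFrom-off : ∀ {N K} (K<N : K < N) es es<K x → bit K x ≡ false →
                          blockMaps (cnotsFrom K<N es es<K) x ≡ x
blockMaps-cnotsFrom-off K<N []       []           x off = refl
blockMaps-cnotsFrom-off {K = K} K<N (e ∷ es) (e<K ∷ es<K) x off = begin
  blockMap (CNOT e<K K<N) (blockMaps (cnotsFrom K<N es es<K) x)
    ≡⟨ cong (blockMap (CNOT e<K K<N)) (blockMaps-cnotsFrom-off K<N es es<K x off) ⟩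
  blockMap (CNOT e<K K<N) x
    ≡⟨ blockMap-CNOT e<K K<N x ⟩
  (if bit K x then flip e x else x)
    ≡⟨ cong (λ b → if b then flip e x else x) off ⟩
  x
    ∎
  where open ≡-Reasoning

v<[1+v/2^K]*2^K : ∀ K v → v < suc (v /2^ K) * 2 ^ K
v<[1+v/2^K]*2^K K v = begin-strict
  v                                  ≡⟨ m≡m%n+[m/n]*n v (2 ^ K) {{2^k≢0 K}} ⟩
  v %2^ K + v /2^ K * 2 ^ K          <⟨ +-monoˡ-< (v /2^ K * 2 ^ K) (m%n<n v (2 ^ K) {{2^k≢0 K}}) ⟩
  2 ^ K + v /2^ K * 2 ^ K            ∎
  where open ≤-Reasoning

-- The CNOTs only move a position within its aligned slab of 2^K positions when bit K is set,
-- so they stay below l whenever such a slab lies entirely below l.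
blockMaps-cnotsFrom-< : ∀ {N K l} (K<N : K < N) es es<K u → u < l →
                        (bit K u ≡ true → suc (u /2^ K) * 2 ^ K ≤ l) → blockMaps (cnotsFrom K<N es es<K) u < l
blockMaps-cnotsFrom-< {K = K} {l} K<N es es<K u u<l slab<l with bit K u in bitK
... | false = subst (_< l) (sym (blockMaps-cnotsFrom-off K<N es es<K u bitK)) u<l
... | true  = <-≤-trans (subst (λ q → v < suc q * 2 ^ K) v/2^K≡ (v<[1+v/2^K]*2^K K v)) (slab<l refl)
  where
    v = blockMaps (cnotsFrom K<N es es<K) u
    v/2^K≡ : v /2^ K ≡ u /2^ K
    v/2^K≡ = trans (cong (_/2^ K) (blockMaps-cnotsFrom-on K<N es es<K u bitK)) (flips-/2^ es u es<K)

record BlockCircuit (N c w l s : ℕ) : Set where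
  field
    gates      : List (Gate (suc N))
    admissible : AdmissibleSeq c w gates
    blockwise  : All IsBlockwise gates
    below-l    : ∀ t → t < l → blockMaps gates t < l
    l↦s        : blockMaps gates l ≡ s

BlockCircuit-weaken : ∀ {N c c′ w l s} → c ≤ c′ → BlockCircuit N c w l s → BlockCircuit N c′ w l s
BlockCircuit-weaken c≤c′ C = record
  { gates = gates ; admissible = weaken admissible ; blockwise = blockwise ; below-l = below-l ; l↦s = l↦s }
  where
    open BlockCircuit C
    weaken : ∀ {gs} → AdmissibleSeq _ _ gs → AdmissibleSeq _ _ gs
    weaken (pre , mid , post , eq , pre-CNOT , post-CNOT , len≤c , mid≤w) =
      pre , mid , post , eq , pre-CNOT , post-CNOT , ≤-trans len≤c c≤c′ , mid≤w

gateThenCNOTs : ∀ {N K w l s} (K<N : K < N) (mid : Maybe (Gate (suc N))) →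
  All IsBlockwise (maybeList mid) → All (λ g → ∣ ctrl g ∣ ≤ w) (maybeList mid) →
  (∀ t → t < l → blockMaps (maybeList mid) t < l) →
  (∀ u → u < l → bit K u ≡ true → suc (u /2^ K) * 2 ^ K ≤ l) →
  bit K (blockMaps (maybeList mid) l) ≡ true → blockMaps (maybeList mid) l /2^ K ≡ s /2^ K →
  BlockCircuit N K w l s
gateThenCNOTs {N} {K} {w} {l} {s} K<N mid mid-bw mid≤w mid-below slab<l on same-slab = record
  { gates      = cnots ++ maybeList mid ++ []
  ; admissible = cnots , mid , [] , refl , cnotsFrom-CNOT K<N es es<K , [] , length≤K , mid≤w
  ; blockwise  = All.++⁺ (cnotsFrom-blockwise K<N es es<K) (All.++⁺ mid-bw [])
  ; below-l    = λ t t<l → subst (_< l) (sym (blockMaps-split t))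
                   (blockMaps-cnotsFrom-< K<N es es<K _ (mid-below t t<l) (slab<l _ (mid-below t t<l)))
  ; l↦s        = trans (blockMaps-split l)
                   (trans (blockMaps-cnotsFrom-on K<N es es<K x on) (flips-diffBits K x s same-slab))
  }
  where
    x = blockMaps (maybeList mid) l
    es = diffBits K x s
    es<K = diffBits-< K x s
    cnots = cnotsFrom K<N es es<K
    blockMaps-split : ∀ t → blockMaps (cnots ++ maybeList mid ++ []) t ≡
                            blockMaps cnots (blockMaps (maybeList mid) t)
    blockMaps-split t =
      trans (blockMaps-++ cnots _ t) (cong (blockMaps cnots) (blockMaps-++ (maybeList mid) [] t))
    length≤K : length cnots + length {A = Gate (suc N)} [] ≤ K
    length≤K = subst (_≤ K) (sym (trans (+-identityʳ _) (length-cnotsFrom K<N es es<K)))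
                     (length-diffBits K x s)

bit-quotient : ∀ K x {q} → x /2^ K ≡ q → bit K x ≡ (q % 2 ≡ᵇ 1)
bit-quotient K x eq = trans (bit-/2^ K x) (cong (λ q → q % 2 ≡ᵇ 1) eq)

alignedSlabCircuit : ∀ {N K} E {l s} w → K < N → l ≡ suc (2 * E) * 2 ^ K → s /2^ K ≡ suc (2 * E) →
                     BlockCircuit N K w l s
alignedSlabCircuit {N} {K} E {l} {s} w K<N l≡ s/2^K≡ =
  gateThenCNOTs K<N nothing [] [] (λ t t<l → t<l) slab<l bitK-l (trans l/2^K≡ (sym s/2^K≡))
  where
    l/2^K≡ : l /2^ K ≡ suc (2 * E)
    l/2^K≡ = trans (cong (_/2^ K) l≡) (m*n/n≡m (suc (2 * E)) (2 ^ K) {{2^k≢0 K}})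
    bitK-l : bit K l ≡ true
    bitK-l = trans (bit-quotient K l l/2^K≡) (cong (_≡ᵇ 1) ([b+2q]%2≡b E {1} (s≤s z<s)))
    slab<l : ∀ u → u < l → bit K u ≡ true → suc (u /2^ K) * 2 ^ K ≤ l
    slab<l u u<l _ = subst (suc (u /2^ K) * 2 ^ K ≤_) (sym l≡)
      (*-monoˡ-≤ (2 ^ K) (m<n*o⇒m/o<n {u} {suc (2 * E)} {{2^k≢0 K}} (subst (u <_) l≡ u<l)))

odd≤even⇒< : ∀ b E → b % 2 ≡ 1 → b ≤ 2 * E → b < 2 * E
odd≤even⇒< b E b-odd b≤2E = ≤∧≢⇒< b≤2E λ b≡2E →
  0≢1+n (trans (sym ([b+2q]%2≡b E {0} z<s)) (trans (cong (_% 2) (sym b≡2E)) b-odd))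

bits⊆⇒≤-%2^ : ∀ {K i} t → i < 2 ^ K → BitsSubset i t → i ≤ t %2^ K
bits⊆⇒≤-%2^ {K} {i} t i<2^K i⊆t = bits⊆⇒≤ i (t %2^ K) λ e bite →
  trans (bit-%2^ {K = K} t (bit⇒< e i i<2^K bite)) (i⊆t e bite)

-- A position below l = i + 2E·2^K that the CX gate moves up contains the bits of i, so its slab
-- index t / 2^K is even and smaller than 2E.
flip-up-< : ∀ {K E i l} t → i < 2 ^ K → l ≡ i + 2 * E * 2 ^ K → t < l →
            BitsSubset i t → bit K t ≡ false → t + 2 ^ K < l
flip-up-< {K} {E} {i} {l} t i<W l≡ t<l i⊆t bitK-t = begin-strict
  t + W               ≡⟨ +-comm t W ⟩
  W + t               <⟨ +-monoʳ-< W (v<[1+v/2^K]*2^K K t) ⟩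
  suc (suc a) * W     ≤⟨ *-monoˡ-≤ W (odd≤even⇒< (suc a) E 1+a-odd a<2E) ⟩
  2 * E * W           ≤⟨ m≤n+m (2 * E * W) i ⟩
  i + 2 * E * W       ≡⟨ l≡ ⟨
  l                   ∎
  where
    open ≤-Reasoning
    W = 2 ^ K
    a = t /2^ K
    a<2E : a < 2 * E
    a<2E = ≰⇒> λ 2E≤a → <-irrefl refl (<-≤-trans t<l (begin
      l                      ≡⟨ l≡ ⟩
      i + 2 * E * W          ≤⟨ +-mono-≤ (bits⊆⇒≤-%2^ {K} t i<W i⊆t) (*-monoˡ-≤ W 2E≤a) ⟩
      t %2^ K + a * W        ≡⟨ m≡m%n+[m/n]*n t W {{2^k≢0 K}} ⟨
      t                      ∎))
    1+a-odd : suc a % 2 ≡ 1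
    1+a-odd = trans (cong (λ z → suc z % 2) (trans (m≡m%2+[m/2]*2 a) (cong (_+ a / 2 * 2) (bit-false K t bitK-t))))
                    ([r+q*d]%d≡r (a / 2) {1} (s≤s z<s))

blockMap-CXbits-< : ∀ {N K E l} i (K<N : K < N) (i<2^K : i < 2 ^ K) → l ≡ i + 2 * E * 2 ^ K →
                    ∀ t → t < l → blockMap (CXbits i K<N i<2^K) t < l
blockMap-CXbits-< {N} {K} {E} i K<N i<2^K l≡ t t<l rewrite blockMap-CXbits i K<N i<2^K t
  with controlsOn (suc N) (blockControls N i) (2 * t) in on | bit K t in bitK
... | false | _     = t<l
... | true  | true  = ≤-<-trans (m∸n≤m t (2 ^ K)) t<l
... | true  | false = flip-up-< {K} {E} t i<2^K l≡ t<l (controlsOn-blockControls⇒ N i t i<2^N on) bitK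
  where i<2^N = <-≤-trans i<2^K (^-monoʳ-≤ 2 (<⇒≤ K<N))

innerSlabCircuit : ∀ {N K} E i {l s} → (K<N : K < N) → (i<2^K : i < 2 ^ K) →
                   l ≡ i + 2 * E * 2 ^ K → s /2^ K ≡ suc (2 * E) → BlockCircuit N K (HW i) l s
innerSlabCircuit {N} {K} E i {l} {s} K<N i<W l≡ s/W≡ =
  gateThenCNOTs K<N (just G) (CXbits-blockwise i K<N i<W ∷ []) (∣blockControls∣≤HW N i ∷ [])
    (blockMap-CXbits-< {E = E} i K<N i<W l≡) slab<l bitK-Gl (trans Gl/W≡ (sym s/W≡))
  where
    W = 2 ^ K
    G = CXbits i K<N i<W
    l/W≡ : l /2^ K ≡ 2 * E
    l/W≡ = trans (cong (_/2^ K) l≡) ([r+q*d]/d≡q (2 * E) {{2^k≢0 K}} i<W)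
    i⊆l : BitsSubset i l
    i⊆l e bite = trans (sym (bit-%2^ {K = K} l (bit⇒< e i i<W bite)))
      (trans (cong (bit e) (trans (cong (_%2^ K) l≡) ([r+q*d]%d≡r (2 * E) {{2^k≢0 K}} i<W))) bite)
    Gl≡ : blockMap G l ≡ l + W
    Gl≡ = trans (blockMap-CXbits i K<N i<W l)
      (trans (cong (λ b → if b then flip K l else l) (controlsOn-blockControls⇐ N i l i⊆l))
             (flip-false K l (trans (bit-quotient K l l/W≡) (cong (_≡ᵇ 1) ([b+2q]%2≡b E {0} z<s)))))
    Gl/W≡ : blockMap G l /2^ K ≡ suc (2 * E)
    Gl/W≡ = trans (cong (_/2^ K) (trans Gl≡ (trans (cong (_+ W) l≡) (+-assoc i _ W))))
                  (trans (cong (λ z → (i + z) /2^ K) (+-comm (2 * E * W) W))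
                         ([r+q*d]/d≡q (suc (2 * E)) {{2^k≢0 K}} i<W))
    bitK-Gl : bit K (blockMap G l) ≡ true
    bitK-Gl = trans (bit-quotient K _ Gl/W≡) (cong (_≡ᵇ 1) ([b+2q]%2≡b E {1} (s≤s z<s)))
    slab<l : ∀ u → u < l → bit K u ≡ true → suc (u /2^ K) * W ≤ l
    slab<l u u<l bitK-u = ≤-trans (*-monoˡ-≤ W u/W<2E) (subst (2 * E * W ≤_) (sym l≡) (m≤n+m (2 * E * W) i))
      where
        u/W<2E = odd≤even⇒< (u /2^ K) E (bit-true K u bitK-u)
                   (subst (u /2^ K ≤_) l/W≡ (/-monoˡ-≤ W {{2^k≢0 K}} (<⇒≤ u<l)))

leadingBit : ∀ N s → 0 < s → s < 2 ^ N → Σ ℕ λ K → K < N × s /2^ K ≡ 1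
leadingBit zero    s 0<s s<1 = ⊥-elim (<-irrefl refl (<-≤-trans s<1 0<s))
leadingBit (suc N) s 0<s s<2^N+1 with s <? 2 ^ N
... | yes s<2^N = let (K , K<N , s/2^K≡1) = leadingBit N s 0<s s<2^N in K , m<n⇒m<1+n K<N , s/2^K≡1
... | no  s≮2^N = N , n<1+n N ,
  ≤-antisym (≤-pred (m<n*o⇒m/o<n {{2^k≢0 N}} s<2^N+1)) (m≥n⇒m/n>0 {{2^k≢0 N}} (≮⇒≥ s≮2^N))

circuitFrom0 : ∀ {N} s → s < 2 ^ N → BlockCircuit N N 0 0 s
circuitFrom0 zero      _     = record
  { gates = [] ; admissible = [] , nothing , [] , refl , [] , [] , z≤n , []
  ; blockwise = [] ; below-l = λ _ () ; l↦s = refl }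
circuitFrom0 {N} s@(suc _) s<2^N = let (K , K<N , s/2^K≡1) = leadingBit N s z<s s<2^N in
  BlockCircuit-weaken (<⇒≤ K<N) (innerSlabCircuit 0 0 K<N (m^n>0 2 K) refl s/2^K≡1)

-- Locating l and s

/2^-slab : ∀ K q {s} → q * 2 ^ K ≤ s → s < suc q * 2 ^ K → s /2^ K ≡ q
/2^-slab K q {s} qW≤s s<[1+q]W = ≤-antisym (≤-pred (m<n*o⇒m/o<n {{2^k≢0 K}} s<[1+q]W))
  (subst (_≤ s /2^ K) (m*n/n≡m q (2 ^ K) {{2^k≢0 K}}) (/-monoˡ-≤ (2 ^ K) {{2^k≢0 K}} qW≤s))

sumPow+2^ : ∀ n k → k < n → sumPow n (suc k) + 2 ^ (n ∸ k) ≡ 2 ^ n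
sumPow+2^ n zero    _   = refl
sumPow+2^ n (suc k) k<n = begin
  S + X + X                ≡⟨ +-assoc S X X ⟩
  S + (X + X)              ≡⟨ cong (λ z → S + (X + z)) (+-identityʳ X) ⟨
  S + 2 ^ suc (n ∸ suc k)  ≡⟨ cong (λ z → S + 2 ^ z) (+-∸-assoc 1 (<⇒≤ k<n)) ⟨
  S + 2 ^ (n ∸ k)          ≡⟨ sumPow+2^ n k (<-trans (n<1+n k) k<n) ⟩
  2 ^ n                    ∎
  where
    open ≡-Reasoning
    S = sumPow n (suc k)
    X = 2 ^ (n ∸ suc k)

sumPow≡h : ∀ n k → k < n → sumPow n (suc k) ≡ h n (suc k)
sumPow≡h n k k<n =
  trans (sym (m+n∸n≡m (sumPow n (suc k)) (2 ^ (n ∸ k)))) (cong (_∸ 2 ^ (n ∸ k)) (sumPow+2^ n k k<n))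

m≤n⇐minimal : ∀ N l m → l < 2 ^ N → (∀ m′ → 1 ≤ m′ → m′ < m → ¬ (2 * l ≤ sumPow (suc N) m′)) →
              m ≤ suc N
m≤n⇐minimal N l m l<2^N minimal with m ≤? suc N
... | yes m≤n = m≤n
... | no  m≰n = ⊥-elim (minimal (suc N) (s≤s z≤n) (≰⇒> m≰n) 2l≤sumPow)
  where
    2l≤sumPow : 2 * l ≤ sumPow (suc N) (suc N)
    2l≤sumPow = +-cancelʳ-≤ 2 (2 * l) _ (begin
      2 * l + 2                                ≡⟨ trans (+-comm (2 * l) 2) (sym (*-suc 2 l)) ⟩
      2 * suc l                                ≤⟨ *-monoʳ-≤ 2 l<2^N ⟩
      2 ^ suc N                                ≡⟨ sumPow+2^ (suc N) N (n<1+n N) ⟨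
      sumPow (suc N) (suc N) + 2 ^ (suc N ∸ N)  ≡⟨ cong (λ e → sumPow (suc N) (suc N) + 2 ^ e) (m+n∸n≡m 1 N) ⟩
      sumPow (suc N) (suc N) + 2                ∎)
      where open ≤-Reasoning

m+[n+o]∸n≡m+o : ∀ m n o → m + (n + o) ∸ n ≡ m + o
m+[n+o]∸n≡m+o m n o = trans (cong (_∸ n) (swap m n o)) (m+n∸m≡n n (m + o))
  where
    swap : ∀ m n o → m + (n + o) ≡ n + (m + o)
    swap = solve-∀

-- With N = 1 + a + K, W = 2^K and E = 2^a - 1 we have 2^N = (2E + 2) W, so h (N + 1) (a + 2) and
-- h (N + 1) (a + 1) are twice the left ends (2E + 1) W and 2E W of the last two slabs of width W.
2^[1+a+K]≡ : ∀ a K → 2 ^ suc (a + K) ≡ suc (suc (2 * pred (2 ^ a))) * 2 ^ K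
2^[1+a+K]≡ a K = begin
  2 * 2 ^ (a + K)                    ≡⟨ cong (2 *_) (^-distribˡ-+-* 2 a K) ⟩
  2 * (2 ^ a * 2 ^ K)                ≡⟨ cong (λ z → 2 * (z * 2 ^ K)) (suc-pred (2 ^ a) {{2^k≢0 a}}) ⟨
  2 * (suc E * 2 ^ K)                ≡⟨ double (pred (2 ^ a)) (2 ^ K) ⟩
  suc (suc (2 * E)) * 2 ^ K          ∎
  where
    open ≡-Reasoning
    E = pred (2 ^ a)
    double : ∀ E W → 2 * (suc E * W) ≡ suc (suc (2 * E)) * W
    double = solve-∀

h-top-slab : ∀ a K → h (2 + (a + K)) (2 + a) ≡ 2 * (suc (2 * pred (2 ^ a)) * 2 ^ K)
h-top-slab a K = begin
  2 ^ (2 + (a + K)) ∸ 2 ^ (1 + (a + K) ∸ a)          ≡⟨ cong₂ (λ x e → 2 * x ∸ 2 ^ e) (2^[1+a+K]≡ a K)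
                                                                                     (m+[n+o]∸n≡m+o 1 a K) ⟩
  2 * (suc (suc (2 * E)) * W) ∸ 2 * W                ≡⟨ cong (_∸ 2 * W) (split E W) ⟩
  2 * (suc (2 * E) * W) + 2 * W ∸ 2 * W              ≡⟨ m+n∸n≡m _ (2 * W) ⟩
  2 * (suc (2 * E) * W)                              ∎
  where
    open ≡-Reasoning
    E = pred (2 ^ a)
    W = 2 ^ K
    split : ∀ E W → 2 * (suc (suc (2 * E)) * W) ≡ 2 * (suc (2 * E) * W) + 2 * W
    split = solve-∀

h-next-slab : ∀ a K → h (2 + (a + K)) (1 + a) ≡ 2 * (2 * pred (2 ^ a) * 2 ^ K)
h-next-slab a K = begin
  2 ^ (2 + (a + K)) ∸ 2 ^ (2 + (a + K) ∸ a)          ≡⟨ cong₂ (λ x e → 2 * x ∸ 2 ^ e) (2^[1+a+K]≡ a K)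
                                                                                     (m+[n+o]∸n≡m+o 2 a K) ⟩
  2 * (suc (suc (2 * E)) * W) ∸ 2 * (2 * W)          ≡⟨ cong (_∸ 2 * (2 * W)) (split E W) ⟩
  2 * (2 * E * W) + 2 * (2 * W) ∸ 2 * (2 * W)        ≡⟨ m+n∸n≡m _ (2 * (2 * W)) ⟩
  2 * (2 * E * W)                                    ∎
  where
    open ≡-Reasoning
    E = pred (2 ^ a)
    W = 2 ^ K
    split : ∀ E W → 2 * (suc (suc (2 * E)) * W) ≡ 2 * (2 * E * W) + 2 * (2 * W)
    split = solve-∀

topSlabCircuit : ∀ {N} a K {l s} → N ≡ suc (a + K) →
  2 * l ≤ sumPow (suc N) (2 + a) → ¬ (2 * l ≤ sumPow (suc N) (1 + a)) →
  s < 2 ^ N → h (suc N) (2 + a) ≤ 2 * s →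
  BlockCircuit N (suc N ∸ (2 + a)) (HW (i′ (suc N) l (2 + a))) l s
topSlabCircuit a K {l} {s} refl 2l≤sumPow 2l≰sumPow s<2^N h≤2s =
  subst₂ (λ c j → BlockCircuit (suc (a + K)) c (HW j) l s) (sym (m+n∸m≡n a K)) (sym i′≡i)
         (circuit (i <? W))
  where
    n = 2 + (a + K)
    E = pred (2 ^ a)
    W = 2 ^ K
    Y = 2 * E * W
    sumPow≡top : sumPow n (2 + a) ≡ 2 * (W + Y)
    sumPow≡top = trans (sumPow≡h n (1 + a) (s≤s (s≤s (m≤m+n a K)))) (h-top-slab a K)
    sumPow≡next : sumPow n (1 + a) ≡ 2 * Y
    sumPow≡next = trans (sumPow≡h n a (s≤s (m≤n⇒m≤1+n (m≤m+n a K)))) (h-next-slab a K)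
    K<N : K < suc (a + K)
    K<N = s≤s (m≤n+m K a)
    l≤W+Y : l ≤ W + Y
    l≤W+Y = *-cancelˡ-≤ 2 (subst (2 * l ≤_) sumPow≡top 2l≤sumPow)
    Y<l : Y < l
    Y<l = *-cancelˡ-< 2 Y l (≰⇒> λ 2l≤2Y → 2l≰sumPow (subst (2 * l ≤_) (sym sumPow≡next) 2l≤2Y))
    s/W≡ : s /2^ K ≡ suc (2 * E)
    s/W≡ = /2^-slab K (suc (2 * E)) (*-cancelˡ-≤ 2 (subst (_≤ 2 * s) (h-top-slab a K) h≤2s))
                                     (subst (s <_) (2^[1+a+K]≡ a K) s<2^N)
    i = l ∸ Y
    l≡i+Y : l ≡ i + Y
    l≡i+Y = sym (m∸n+n≡m (<⇒≤ Y<l))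
    i′≡i : i′ n l (2 + a) ≡ i
    i′≡i = trans (cong (λ z → l ∸ z / 2) (h-next-slab a K)) (cong (l ∸_) ([b+2q]/2≡q Y {0} z<s))
    circuit : Dec (i < W) → BlockCircuit (suc (a + K)) K (HW i) l s
    circuit (yes i<W) = innerSlabCircuit E i K<N i<W l≡i+Y s/W≡
    circuit (no  i≮W) = alignedSlabCircuit E (HW i) K<N l≡W+Y s/W≡
      where
        l≡W+Y : l ≡ W + Y
        l≡W+Y = trans l≡i+Y (cong (_+ Y) (≤-antisym i≤W (≮⇒≥ i≮W)))
          where i≤W = +-cancelʳ-≤ Y i W (subst (_≤ W + Y) l≡i+Y l≤W+Y)

blockCircuit : ∀ N l m s → l < 2 ^ N → 1 ≤ m → 2 * l ≤ sumPow (suc N) m →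
  (∀ m′ → 1 ≤ m′ → m′ < m → ¬ (2 * l ≤ sumPow (suc N) m′)) →
  s < 2 ^ N → h (suc N) m ≤ 2 * s → BlockCircuit N (suc N ∸ m) (HW (i′ (suc N) l m)) l s
blockCircuit N l (suc zero) s _ _ 2l≤0 _ s<2^N _ =
  subst (λ l → BlockCircuit N N (HW l) l s) (sym (n≤0⇒n≡0 (*-cancelˡ-≤ 2 2l≤0))) (circuitFrom0 s s<2^N)
blockCircuit N l (suc (suc a)) s l<2^N _ 2l≤sumPow minimal s<2^N h≤2s =
  topSlabCircuit a (N ∸ suc a) (sym (m+[n∸m]≡n a<N))
                 2l≤sumPow (minimal (suc a) (s≤s z≤n) ≤-refl) s<2^N h≤2s
  where
    a<N : a < N
    a<N = ≤-pred (m≤n⇐minimal N l (suc (suc a)) l<2^N minimal)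

blocksMoved : ∀ {N c w l s} P → (∀ t → t < l → HasBlock P t) → HasBlock P s → BlockCircuit N c w l s →
  Σ (List (Gate (suc N))) λ gs →
    AdmissibleSeq c w gs
    × (∀ t → t < l → HasBlock (applyGates P gs) t)
    × (applyGates P gs (2 * l) ≡ P (2 * s))
    × (applyGates P gs (suc (2 * l)) ≡ P (suc (2 * s)))
blocksMoved {l = l} {s} P blocks block-s C =
  gates , admissible , blocks′ , column 0 z<s , column 1 (s≤s z<s)
  where
    open BlockCircuit C
    column : ∀ b → b < 2 → applyGates P gates (b + 2 * l) ≡ P (b + 2 * s)
    column b b<2 = trans (applyGates-block P gates l blockwise b<2) (cong (λ t → P (b + 2 * t)) l↦s)
    blocks′ : ∀ t → t < l → HasBlock (applyGates P gates) t
    blocks′ t t<l = trans (applyGates-block P gates t blockwise (s≤s z<s))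
      (trans (blocks (blockMaps gates t) (below-l t t<l))
             (cong suc (sym (applyGates-block P gates t blockwise z<s))))

lemma2 : (n : ℕ) → 2 ≤ n → (P : ℕ → ℕ) → IsPerm n P
    → (∀ x → x < 2 ^ n → P x % 2 ≡ x % 2)
    → (l : ℕ) → l < 2 ^ (n ∸ 1)
    → (∀ t → t < l → HasBlock P t)
    → (m : ℕ) → 1 ≤ m → 2 * l ≤ sumPow n m
    → (∀ m′ → 1 ≤ m′ → m′ < m → ¬ (2 * l ≤ sumPow n m′))
    → (s : ℕ) → l ≤ s → s < 2 ^ (n ∸ 1) → h n m ≤ 2 * s → HasBlock P s
    → Σ (List (Gate n)) λ gs →
        AdmissibleSeq (n ∸ m) (HW (i′ n l m)) gs
        × (∀ t → t < l → HasBlock (applyGates P gs) t)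
        × (applyGates P gs (2 * l) ≡ P (2 * s))
        × (applyGates P gs (suc (2 * l)) ≡ P (suc (2 * s)))
lemma2 (suc N) _ P _ _ l l<2^N blocks m 1≤m 2l≤sumPow minimal s _ s<2^N h≤2s block-s =
  blocksMoved P blocks block-s (blockCircuit N l m s l<2^N 1≤m 2l≤sumPow minimal s<2^N h≤2s)
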